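{- Let $G=(V,E,\omega,c)$ be a weighted graph and $k\geq 2$ an integer. Then, for each of $\iota_k=\iota^m_k$ and $\iota_k=\iota^M_k$, there exists a $k$-subpartition $\{A_1,\dots,A_k\}\in\mathcal{D}_k(V)$ attaining $\iota_k(G)$ such that the subgraph of $G$ induced on each $A_i$ is connected.
   Context: A weighted graph $G=(V,E,\omega,c)$ is a finite simple graph with vertex weights $\omega:V\to\mathbb{Q}^+$ and edge weights $c:E\to\mathbb{Q}^+$. For $A\subseteq V$, $\omega(A)=\sum_{u\in A}\omega(u)$ and $c(A)$ is the sum of $c(e)$ over edges $e$ with exactly one end in $A$. $\mathcal{D}_k(V)$ is the set of families $\{A_1,\dots,A_k\}$ of pairwise disjoint nonempty subsets of $V$. $\iota^m_k(G)=\min_{\{A_i\}\in\mathcal{D}_k(V)}\frac1k\sum_i c(A_i)/\omega(A_i)$ and $\iota^M_k(G)=\min_{\{A_i\}\in\mathcal{D}_k(V)}\max_i c(A_i)/\omega(A_i)$. -}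

module Defs where

open import Data.Nat using (ℕ; zero; suc)
open import Data.Fin using (Fin; zero; suc)
open import Data.Fin.Subset using (Subset; _∈_; _∉_; Nonempty)
open import Data.Fin.Subset.Properties using (_∈?_)
open import Data.Rational using (ℚ; 0ℚ; _+_; _*_; _÷_; _⊔_; _<_; _≤_; ≢-nonZero; _/_)
open import Data.Rational.Properties using (_≟_)
open import Data.Product using (_×_; Σ)
open import Relation.Nullary using (yes; no; ¬_)
open import Relation.Binary.PropositionalEquality using (_≡_)

-- The edge set is E = { {u,v} : 0 < c u v }; c u v = 0 means "no edge".
record WGraph (n : ℕ) : Set where
  field
    ω       : Fin n → ℚ
    c       : Fin n → Fin n → ℚ
    ω-pos   : ∀ u → 0ℚ < ω u
    c-nonneg : ∀ u v → 0ℚ ≤ c u v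
    c-sym   : ∀ u v → c u v ≡ c v u
    c-loop  : ∀ u → c u u ≡ 0ℚ

sumFin : (n : ℕ) → (Fin n → ℚ) → ℚ
sumFin zero    f = 0ℚ
sumFin (suc n) f = f zero + sumFin n (λ i → f (suc i))

-- maximum over Fin k (only meaningful for k ≥ 1)
maxFin : (k : ℕ) → (Fin k → ℚ) → ℚ
maxFin zero          f = 0ℚ
maxFin (suc zero)    f = f zero
maxFin (suc (suc k)) f = f zero ⊔ maxFin (suc k) (λ i → f (suc i))

-- total division (the denominator is never 0 where it is used below)
_/'_ : ℚ → ℚ → ℚ
p /' q with q ≟ 0ℚ
... | yes _  = 0ℚ
... | no q≢0 = _÷_ p q {{≢-nonZero q≢0}}

restrict : ∀ {n} → Subset n → Fin n → ℚ → ℚ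
restrict A u x with u ∈? A
... | yes _ = x
... | no  _ = 0ℚ

module _ {n : ℕ} (G : WGraph n) where
  open WGraph G

  ωS : Subset n → ℚ
  ωS A = sumFin n (λ u → restrict A u (ω u))

  -- c(A) = Σ of c(e) over edges e with exactly one end in A
  --      = Σ_{u ∈ A} Σ_{v ∉ A} c u v
  cS : Subset n → ℚ
  cS A = sumFin n (λ u → restrict A u
           (sumFin n (λ v → cut u v)))
    where
    cut : Fin n → Fin n → ℚ
    cut u v with v ∈? A
    ... | yes _ = 0ℚ
    ... | no  _ = c u v

  ratio : Subset n → ℚ
  ratio A = cS A /' ωS A

  -- D_k(V): k pairwise disjoint nonempty subsets of V
  -- (indexed by Fin k; disjoint nonempty sets are automatically distinct)
  IsSubpartition : (k : ℕ) → (Fin k → Subset n) → Set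
  IsSubpartition k A =
    (∀ i → Nonempty (A i)) ×
    (∀ i j → ¬ (i ≡ j) → ∀ u → u ∈ A i → u ∉ A j)

  objm : (k : ℕ) → (Fin k → Subset n) → ℚ
  objm k A = sumFin k (λ i → ratio (A i)) /' (Data.Rational._/_ (Data.Integer.+ k) 1)
    where import Data.Integer

  objM : (k : ℕ) → (Fin k → Subset n) → ℚ
  objM k A = maxFin k (λ i → ratio (A i))

  Attains : (k : ℕ) → ((Fin k → Subset n) → ℚ) → (Fin k → Subset n) → Set
  Attains k obj A = IsSubpartition k A ×
    (∀ B → IsSubpartition k B → obj A ≤ obj B)

  data PathIn (A : Subset n) : Fin n → Fin n → Set where
    here : ∀ {u} → u ∈ A → PathIn A u u
    step : ∀ {u w v} → u ∈ A → 0ℚ < c u w → PathIn A w v → PathIn A u v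

  -- G[A] is connected (A nonempty is required separately by D_k)
  InducedConnected : Subset n → Set
  InducedConnected A = ∀ u v → u ∈ A → v ∈ A → PathIn A u v

module Submission where

-- Both objectives ι^m_k and ι^M_k are monotone functions of the vector of
-- ratios c(A_i)/ω(A_i).  The proof therefore has two independent halves.
--
-- (1) Existence of a minimiser.  There are finitely many families
--     Fin k → Subset n; listing them all and taking an argmin over the
--     subpartitions among them (the singleton family {v_1},…,{v_k} shows
--     there is one, as k ≤ n) gives a family attaining ι_k.
-- (2) Connected refinement.  Every nonempty S ⊆ V contains a nonempty S'
--     inducing a connected subgraph with c(S')/ω(S') ≤ c(S)/ω(S).  If G[S]
--     is disconnected, split S into the component T of some vertex and the
--     rest R.  No edge joins T and R, so ω and c are additive over S = T ⊎ R,
--     and by the mediant inequality one of T, R has ratio at most that of S;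
--     recurse on it (well-founded on |S|).
--
-- Refining every part of a minimiser keeps the parts disjoint and nonempty
-- and, by monotonicity, does not increase the objective: the result is a
-- minimiser with connected parts.

open import Defs
open import Data.Nat using (ℕ; zero; suc) renaming (_≤_ to _≤ℕ_; _<_ to _<ℕ_)
open import Data.Nat.Induction using (<-wellFounded)
open import Induction.WellFounded using (Acc; acc)
open import Data.Rational
  using (ℚ; 0ℚ; 1ℚ; _+_; _*_; _<_; _≤_; 1/_; normalize; ≢-nonZero; positive; nonNegative)
open import Data.Rational.Properties
open import Data.Bool using (true; false)
open import Data.Fin using (Fin; zero; suc; inject≤) renaming (_≟_ to _≟Fin_)
open import Data.Fin.Properties using (any?; all?; inject≤-injective)
open import Data.Fin.Subset using (Subset; _∈_; _∉_; _⊆_; Nonempty; ∣_∣; _-_; ⁅_⁆)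
open import Data.Fin.Subset.Properties
  using (_∈?_; nonempty?; p⊂q⇒∣p∣<∣q∣; x∈p⇒∣p-x∣<∣p∣; p─q⊆p; x∈p∧x≢y⇒x∈p-y; x∈⁅x⁆; x∈⁅y⁆⇒x≡y)
open import Data.Vec using (Vec; []; _∷_; tabulate; lookup)
open import Data.Vec.Properties using (lookup∘tabulate; lookup⇒[]=; []=⇒lookup)
open import Data.List using (List; []; _∷_; [_]; map; filter; cartesianProductWith)
import Data.List.Membership.Propositional as List
open import Data.List.Membership.Propositional.Properties
  using (∈-map⁺; ∈-filter⁺; ∈-cartesianProductWith⁺)
open import Data.List.Relation.Unary.Any using (here; there)
import Data.List.Relation.Unary.All as All
open import Data.List.Relation.Unary.All.Properties using (all-filter)
open import Relation.Binary.Bundles using (DecTotalOrder)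
open import Data.List.Extrema (DecTotalOrder.totalOrder ≤-decTotalOrder)
  using (argmin; argmin-all; f[argmin]≤f[xs])
open import Algebra.Bundles using (CommutativeMonoid)
open import Algebra.Properties.CommutativeSemigroup
  (CommutativeMonoid.commutativeSemigroup +-0-commutativeMonoid) using (interchange)
open import Data.Product using (_×_; Σ; ∃; _,_; proj₁; proj₂)
open import Data.Sum using (_⊎_; inj₁; inj₂)
import Data.Sum as Sum
open import Data.Empty using (⊥-elim)
open import Function using (_∘_)
open import Relation.Nullary using (Dec; yes; no; ¬_; does)
open import Relation.Nullary.Decidable using (_×-dec_; _→-dec_; ¬?; dec-true)
open import Relation.Unary using (Decidable)
open import Relation.Binary.PropositionalEquality using (_≡_; refl; sym; trans; cong; cong₂; subst; module ≡-Reasoning)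

/'-*-cancel : ∀ x {d} → 0ℚ < d → (x /' d) * d ≡ x
/'-*-cancel x {d} 0<d with d ≟ 0ℚ
... | yes refl = ⊥-elim (<-irrefl refl 0<d)
... | no d≢0 = begin
    x * 1/ d * d      ≡⟨ *-assoc x (1/ d) d ⟩
    x * (1/ d * d)    ≡⟨ cong (x *_) (*-inverseˡ d) ⟩
    x * 1ℚ            ≡⟨ *-identityʳ x ⟩
    x                 ∎
  where open ≡-Reasoning
        instance _ = ≢-nonZero d≢0

*≤⇒≤/' : ∀ {a x d} → 0ℚ < d → a * d ≤ x → a ≤ x /' d
*≤⇒≤/' {a} {x} {d} 0<d ad≤x =
  *-cancelʳ-≤-pos d {{positive 0<d}} (subst (a * d ≤_) (sym (/'-*-cancel x 0<d)) ad≤x)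

≤/'⇒*≤ : ∀ {a x d} → 0ℚ < d → a ≤ x /' d → a * d ≤ x
≤/'⇒*≤ {a} {x} {d} 0<d a≤x/d =
  subst (a * d ≤_) (/'-*-cancel x 0<d) (*-monoʳ-≤-nonNeg d {{nonNegative (<⇒≤ 0<d)}} a≤x/d)

/'-monoˡ-≤ : ∀ {x y d} → 0ℚ < d → x ≤ y → x /' d ≤ y /' d
/'-monoˡ-≤ {x} {y} 0<d x≤y = *≤⇒≤/' 0<d (subst (_≤ y) (sym (/'-*-cancel x 0<d)) x≤y)

0<+ : ∀ {a b} → 0ℚ < a → 0ℚ < b → 0ℚ < a + b
0<+ {a} {b} 0<a 0<b = subst (_< a + b) (+-identityˡ 0ℚ) (+-mono-< 0<a 0<b)

≤-mediant : ∀ {r x₁ x₂ d₁ d₂} → 0ℚ < d₁ → 0ℚ < d₂ →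
  r ≤ x₁ /' d₁ → r ≤ x₂ /' d₂ → r ≤ (x₁ + x₂) /' (d₁ + d₂)
≤-mediant {r} {x₁} {x₂} {d₁} {d₂} 0<d₁ 0<d₂ r≤q₁ r≤q₂ = *≤⇒≤/' (0<+ 0<d₁ 0<d₂) (begin
  r * (d₁ + d₂)    ≡⟨ *-distribˡ-+ r d₁ d₂ ⟩
  r * d₁ + r * d₂  ≤⟨ +-mono-≤ (≤/'⇒*≤ 0<d₁ r≤q₁) (≤/'⇒*≤ 0<d₂ r≤q₂) ⟩
  x₁ + x₂          ∎)
  where open ≤-Reasoning

-- Mediant inequality: min(x₁/d₁, x₂/d₂) ≤ (x₁ + x₂)/(d₁ + d₂) for positive
-- d₁, d₂, in the constructive form "one of the two quotients is below".
mediant : ∀ x₁ x₂ {d₁ d₂} → 0ℚ < d₁ → 0ℚ < d₂ →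
  (x₁ /' d₁ ≤ (x₁ + x₂) /' (d₁ + d₂)) ⊎ (x₂ /' d₂ ≤ (x₁ + x₂) /' (d₁ + d₂))
mediant x₁ x₂ {d₁} {d₂} 0<d₁ 0<d₂ with ≤-total (x₁ /' d₁) (x₂ /' d₂)
... | inj₁ q₁≤q₂ = inj₁ (≤-mediant 0<d₁ 0<d₂ ≤-refl q₁≤q₂)
... | inj₂ q₂≤q₁ = inj₂ (≤-mediant 0<d₁ 0<d₂ q₂≤q₁ ≤-refl)

sumFin-cong : ∀ m {f g : Fin m → ℚ} → (∀ i → f i ≡ g i) → sumFin m f ≡ sumFin m g
sumFin-cong zero    f≡g = refl
sumFin-cong (suc m) f≡g = cong₂ _+_ (f≡g zero) (sumFin-cong m (f≡g ∘ suc))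

sumFin-+ : ∀ m (f g : Fin m → ℚ) → sumFin m (λ i → f i + g i) ≡ sumFin m f + sumFin m g
sumFin-+ zero    f g = sym (+-identityˡ 0ℚ)
sumFin-+ (suc m) f g = trans (cong ((f zero + g zero) +_) (sumFin-+ m (f ∘ suc) (g ∘ suc)))
                             (interchange (f zero) (g zero) _ _)

sumFin-mono : ∀ m {f g : Fin m → ℚ} → (∀ i → f i ≤ g i) → sumFin m f ≤ sumFin m g
sumFin-mono zero    f≤g = ≤-refl
sumFin-mono (suc m) f≤g = +-mono-≤ (f≤g zero) (sumFin-mono m (f≤g ∘ suc))

sumFin-nonneg : ∀ m {f : Fin m → ℚ} → (∀ i → 0ℚ ≤ f i) → 0ℚ ≤ sumFin m f
sumFin-nonneg zero    f≥0 = ≤-refl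
sumFin-nonneg (suc m) {f} f≥0 =
  subst (_≤ sumFin (suc m) f) (+-identityˡ 0ℚ) (+-mono-≤ (f≥0 zero) (sumFin-nonneg m (f≥0 ∘ suc)))

sumFin-pos : ∀ m {f : Fin m → ℚ} → (∀ i → 0ℚ ≤ f i) → (j : Fin m) → 0ℚ < f j → 0ℚ < sumFin m f
sumFin-pos (suc m) {f} f≥0 zero    0<fj =
  subst (_< sumFin (suc m) f) (+-identityˡ 0ℚ) (+-mono-<-≤ 0<fj (sumFin-nonneg m (f≥0 ∘ suc)))
sumFin-pos (suc m) {f} f≥0 (suc j) 0<fj =
  subst (_< sumFin (suc m) f) (+-identityˡ 0ℚ) (+-mono-≤-< (f≥0 zero) (sumFin-pos m (f≥0 ∘ suc) j 0<fj))

maxFin-mono : ∀ m {f g : Fin m → ℚ} → (∀ i → f i ≤ g i) → maxFin m f ≤ maxFin m g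
maxFin-mono zero          f≤g = ≤-refl
maxFin-mono (suc zero)    f≤g = f≤g zero
maxFin-mono (suc (suc m)) f≤g = ⊔-mono-≤ (f≤g zero) (maxFin-mono (suc m) (f≤g ∘ suc))

restrict-∈ : ∀ {n} {A : Subset n} {u} x → u ∈ A → restrict A u x ≡ x
restrict-∈ {A = A} {u} x u∈A with u ∈? A
... | yes _   = refl
... | no u∉A = ⊥-elim (u∉A u∈A)

restrict-∉ : ∀ {n} {A : Subset n} {u} x → u ∉ A → restrict A u x ≡ 0ℚ
restrict-∉ {A = A} {u} x u∉A with u ∈? A
... | yes u∈A = ⊥-elim (u∉A u∈A)
... | no _    = refl

restrict-nonneg : ∀ {n} (A : Subset n) u {x} → 0ℚ ≤ x → 0ℚ ≤ restrict A u x
restrict-nonneg A u 0≤x with u ∈? A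
... | yes _ = 0≤x
... | no _  = ≤-refl

select : ∀ {n} {P : Fin n → Set} → Decidable P → Subset n
select P? = tabulate (does ∘ P?)

does-true : ∀ {A : Set} (a? : Dec A) → does a? ≡ true → A
does-true (yes a) _ = a

select⁺ : ∀ {n} {P : Fin n → Set} (P? : Decidable P) {x} → P x → x ∈ select P?
select⁺ P? {x} px = lookup⇒[]= x _ (trans (lookup∘tabulate (does ∘ P?) x) (dec-true (P? x) px))

select⁻ : ∀ {n} {P : Fin n → Set} (P? : Decidable P) {x} → x ∈ select P? → P x
select⁻ P? {x} x∈ = does-true (P? x) (trans (sym (lookup∘tabulate (does ∘ P?) x)) ([]=⇒lookup x∈))

vectors : ∀ {X : Set} → List X → (k : ℕ) → List (Vec X k)
vectors xs zero    = [ [] ]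
vectors xs (suc k) = cartesianProductWith _∷_ xs (vectors xs k)

vectors-complete : ∀ {X : Set} {xs : List X} → (∀ x → x List.∈ xs) →
  ∀ {k} (v : Vec X k) → v List.∈ vectors xs k
vectors-complete every []      = here refl
vectors-complete every (x ∷ v) = ∈-cartesianProductWith⁺ _∷_ (every x) (vectors-complete every v)

subsets : ∀ n → List (Subset n)
subsets = vectors (true ∷ false ∷ [])

subsets-complete : ∀ {n} (A : Subset n) → A List.∈ subsets n
subsets-complete = vectors-complete λ { true → here refl ; false → there (here refl) }

families : ∀ n k → List (Fin k → Subset n)
families n k = map lookup (vectors (subsets n) k)

families-complete : ∀ {n k} (B : Fin k → Subset n) →
  ∃ λ F → F List.∈ families n k × (∀ i → F i ≡ B i)
families-complete B =
  lookup (tabulate B) , ∈-map⁺ lookup (vectors-complete subsets-complete (tabulate B)) , lookup∘tabulate B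

module _ {n : ℕ} (G : WGraph n) where
  open WGraph G

  -- The summand c(u,v)·[v ∉ A] of c(A) is a local function of the
  -- definition of cS; unifying against the unfolded cS gives it a name.
  summandOf : (A : Subset n) {h : Fin n → Fin n → ℚ} →
    cS G A ≡ sumFin n (λ u → restrict A u (sumFin n (h u))) → Fin n → Fin n → ℚ
  summandOf A {h} _ = h

  -- leaving A u v is the weight of the edge uv when v ∉ A, and 0 otherwise.
  leaving : Subset n → Fin n → Fin n → ℚ
  leaving A = summandOf A refl

  leaving-shrink : ∀ {S T} u → T ⊆ S → (∀ {v} → v ∈ S → v ∉ T → c u v ≡ 0ℚ) →
    ∀ v → leaving S u v ≡ leaving T u v
  leaving-shrink {S} {T} u T⊆S noEdge v with v ∈? S | v ∈? T
  ... | yes _   | yes _   = refl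
  ... | yes v∈S | no v∉T  = sym (noEdge v∈S v∉T)
  ... | no v∉S  | yes v∈T = ⊥-elim (v∉S (T⊆S v∈T))
  ... | no _    | no _    = refl

  ωS-pos : ∀ {A} → Nonempty A → 0ℚ < ωS G A
  ωS-pos {A} (u , u∈A) =
    sumFin-pos n (λ v → restrict-nonneg A v (<⇒≤ (ω-pos v))) u
      (subst (0ℚ <_) (sym (restrict-∈ (ω u) u∈A)) (ω-pos u))

  record Separation (S T R : Subset n) : Set where
    field
      cover  : ∀ {x} → x ∈ S → (x ∈ T × x ∉ R) ⊎ (x ∈ R × x ∉ T)
      T⊆S    : T ⊆ S
      R⊆S    : R ⊆ S
      noEdge : ∀ {x y} → x ∈ T → y ∈ R → c x y ≡ 0ℚ

  separation-swap : ∀ {S T R} → Separation S T R → Separation S R T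
  separation-swap sep = record
    { cover = Sum.swap ∘ cover ; T⊆S = R⊆S ; R⊆S = T⊆S
    ; noEdge = λ {x} {y} x∈R y∈T → trans (c-sym x y) (noEdge y∈T x∈R) }
    where open Separation sep

  leaving-side : ∀ {S T R} → Separation S T R → ∀ u → u ∈ T →
    sumFin n (leaving S u) ≡ sumFin n (leaving T u)
  leaving-side {S} {T} sep u u∈T = sumFin-cong n (leaving-shrink u T⊆S noEdgeOutside)
    where
    open Separation sep
    noEdgeOutside : ∀ {v} → v ∈ S → v ∉ T → c u v ≡ 0ℚ
    noEdgeOutside v∈S v∉T with cover v∈S
    ... | inj₁ (v∈T , _) = ⊥-elim (v∉T v∈T)
    ... | inj₂ (v∈R , _) = noEdge u∈T v∈R

  module _ {S T R : Subset n} (sep : Separation S T R) where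
    open Separation sep

    restrict-split : ∀ u {a b d} → (u ∈ T → a ≡ b) → (u ∈ R → a ≡ d) →
      restrict S u a ≡ restrict T u b + restrict R u d
    restrict-split u {a} {b} {d} onT onR with u ∈? S
    ... | no u∉S = sym (begin
          restrict T u b + restrict R u d
            ≡⟨ cong₂ _+_ (restrict-∉ b (u∉S ∘ T⊆S)) (restrict-∉ d (u∉S ∘ R⊆S)) ⟩
          0ℚ + 0ℚ
            ≡⟨ +-identityˡ 0ℚ ⟩
          0ℚ ∎)
      where open ≡-Reasoning
    ... | yes u∈S with cover u∈S
    ...   | inj₁ (u∈T , u∉R) =
            trans (onT u∈T) (sym (trans (cong₂ _+_ (restrict-∈ b u∈T) (restrict-∉ d u∉R)) (+-identityʳ b)))
    ...   | inj₂ (u∈R , u∉T) =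
            trans (onR u∈R) (sym (trans (cong₂ _+_ (restrict-∉ b u∉T) (restrict-∈ d u∈R)) (+-identityˡ d)))

    ωS-split : ωS G S ≡ ωS G T + ωS G R
    ωS-split = trans (sumFin-cong n (λ u → restrict-split u (λ _ → refl) (λ _ → refl))) (sumFin-+ n _ _)

    cS-split : cS G S ≡ cS G T + cS G R
    cS-split = trans
      (sumFin-cong n (λ u → restrict-split u (leaving-side sep u) (leaving-side (separation-swap sep) u)))
      (sumFin-+ n _ _)

    ratio-split : Nonempty T → Nonempty R → ratio G T ≤ ratio G S ⊎ ratio G R ≤ ratio G S
    ratio-split neT neR
      rewrite cS-split | ωS-split = mediant (cS G T) (cS G R) (ωS-pos neT) (ωS-pos neR)

  path-start : ∀ {A u v} → PathIn G A u v → u ∈ A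
  path-start (here u∈A)     = u∈A
  path-start (step u∈A _ _) = u∈A

  path-end : ∀ {A u v} → PathIn G A u v → v ∈ A
  path-end (here v∈A)   = v∈A
  path-end (step _ _ p) = path-end p

  path-mono : ∀ {A B u v} → A ⊆ B → PathIn G A u v → PathIn G B u v
  path-mono A⊆B (here u∈A)     = here (A⊆B u∈A)
  path-mono A⊆B (step u∈A e p) = step (A⊆B u∈A) e (path-mono A⊆B p)

  path-++ : ∀ {A u w v} → PathIn G A u w → PathIn G A w v → PathIn G A u v
  path-++ (here _)       q = q
  path-++ (step u∈A e p) q = step u∈A e (path-++ p q)

  path-rev : ∀ {A u v} → PathIn G A u v → PathIn G A v u
  path-rev (here u∈A) = here u∈A
  path-rev {u = u} (step {w = w} u∈A e p) =
    path-++ (path-rev p) (step (path-start p) (subst (0ℚ <_) (c-sym u w) e) (here u∈A))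

  last-visit : ∀ {A} u {x v} → PathIn G A x v →
    v ≡ u ⊎ (¬ x ≡ u × PathIn G (A - u) x v) ⊎ ∃ λ w → 0ℚ < c u w × PathIn G (A - u) w v
  last-visit u {x} (here x∈A) with x ≟Fin u
  ... | yes x≡u = inj₁ x≡u
  ... | no x≢u  = inj₂ (inj₁ (x≢u , here (x∈p∧x≢y⇒x∈p-y x∈A x≢u)))
  last-visit u {x} (step {w = w} x∈A e p) with last-visit u p
  ... | inj₁ v≡u                = inj₁ v≡u
  ... | inj₂ (inj₂ leave)       = inj₂ (inj₂ leave)
  ... | inj₂ (inj₁ (_ , avoid)) with x ≟Fin u
  ...   | yes refl = inj₂ (inj₂ (w , e , avoid))
  ...   | no x≢u   = inj₂ (inj₁ (x≢u , step (x∈p∧x≢y⇒x∈p-y x∈A x≢u) e avoid))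

  -- Reachability in an induced subgraph is decidable: a path u ⇝ v with
  -- u ≢ v starts with an edge uw followed by a path in A - u, and |A - u| < |A|.
  path? : ∀ A → Acc _<ℕ_ ∣ A ∣ → ∀ u v → Dec (PathIn G A u v)
  path? A (acc smaller) u v with u ∈? A | u ≟Fin v
  ... | no u∉A  | _        = no (u∉A ∘ path-start)
  ... | yes u∈A | yes refl = yes (here u∈A)
  ... | yes u∈A | no u≢v
    with any? (λ w → (0ℚ <? c u w) ×-dec path? (A - u) (smaller (x∈p⇒∣p-x∣<∣p∣ u∈A)) w v)
  ...   | yes (w , e , p) = yes (step u∈A e (path-mono (p─q⊆p A _) p))
  ...   | no noExit       = no (λ p → fromLastVisit (last-visit u p))
    where
    fromLastVisit : ¬ (v ≡ u ⊎ (¬ u ≡ u × PathIn G (A - u) u v) ⊎ ∃ λ w → 0ℚ < c u w × PathIn G (A - u) w v)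
    fromLastVisit (inj₁ v≡u)               = u≢v (sym v≡u)
    fromLastVisit (inj₂ (inj₁ (u≢u , _)))  = u≢u refl
    fromLastVisit (inj₂ (inj₂ exit))       = noExit exit

  path-in? : ∀ A u v → Dec (PathIn G A u v)
  path-in? A = path? A (<-wellFounded ∣ A ∣)

  module Component (A : Subset n) (u : Fin n) where
    reached? : Decidable (PathIn G A u)
    reached? = path-in? A u

    unreached? : Decidable (λ v → v ∈ A × ¬ PathIn G A u v)
    unreached? v = (v ∈? A) ×-dec ¬? (reached? v)

    T R : Subset n
    T = select reached?
    R = select unreached?

    T⊆A : T ⊆ A
    T⊆A = path-end ∘ select⁻ reached?

    R⊆A : R ⊆ A
    R⊆A = proj₁ ∘ select⁻ unreached?

    separation : Separation A T R
    separation = record { cover = cover ; T⊆S = T⊆A ; R⊆S = R⊆A ; noEdge = noEdge }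
      where
      cover : ∀ {x} → x ∈ A → (x ∈ T × x ∉ R) ⊎ (x ∈ R × x ∉ T)
      cover {x} x∈A with reached? x
      ... | yes p = inj₁ (select⁺ reached? p , λ x∈R → proj₂ (select⁻ unreached? x∈R) p)
      ... | no ¬p = inj₂ (select⁺ unreached? (x∈A , ¬p) , ¬p ∘ select⁻ reached?)
      noEdge : ∀ {x y} → x ∈ T → y ∈ R → c x y ≡ 0ℚ
      noEdge {x} {y} x∈T y∈R with 0ℚ <? c x y
      ... | no ¬0<c = ≤-antisym (≮⇒≥ ¬0<c) (c-nonneg x y)
      ... | yes 0<c = ⊥-elim (proj₂ (select⁻ unreached? y∈R)
              (path-++ (select⁻ reached? x∈T) (step (T⊆A x∈T) 0<c (here (R⊆A y∈R)))))

    u∈T : u ∈ A → u ∈ T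
    u∈T u∈A = select⁺ reached? (here u∈A)

    connected : u ∈ A → ¬ Nonempty R → InducedConnected G A
    connected u∈A noRest v w v∈A w∈A = path-++ (path-rev (reach v∈A)) (reach w∈A)
      where
      reach : ∀ {x} → x ∈ A → PathIn G A u x
      reach {x} x∈A with reached? x
      ... | yes p = p
      ... | no ¬p = ⊥-elim (noRest (x , select⁺ unreached? (x∈A , ¬p)))

    ∣T∣<∣A∣ : ∀ {r} → r ∈ R → ∣ T ∣ <ℕ ∣ A ∣
    ∣T∣<∣A∣ r∈R = p⊂q⇒∣p∣<∣q∣ (T⊆A , _ , R⊆A r∈R , proj₂ (select⁻ unreached? r∈R) ∘ select⁻ reached?)

    ∣R∣<∣A∣ : u ∈ A → ∣ R ∣ <ℕ ∣ A ∣
    ∣R∣<∣A∣ u∈A = p⊂q⇒∣p∣<∣q∣ (R⊆A , u , u∈A , λ u∈R → proj₂ (select⁻ unreached? u∈R) (here u∈A))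

  record ConnectedRefinement (S : Subset n) : Set where
    field
      part      : Subset n
      part⊆     : part ⊆ S
      nonempty  : Nonempty part
      connected : InducedConnected G part
      ratio≤    : ratio G part ≤ ratio G S

  refinement-widen : ∀ {S T} → T ⊆ S → ratio G T ≤ ratio G S → ConnectedRefinement T → ConnectedRefinement S
  refinement-widen T⊆S T≤S ref = record
    { part = part ; part⊆ = T⊆S ∘ part⊆ ; nonempty = nonempty ; connected = connected
    ; ratio≤ = ≤-trans ratio≤ T≤S }
    where open ConnectedRefinement ref

  connected-refinement : ∀ S → Acc _<ℕ_ ∣ S ∣ → Nonempty S → ConnectedRefinement S
  connected-refinement S (acc smaller) (u , u∈S) = refine (nonempty? R)
    where
    open Component S u

    recurse : ∀ {X} → X ⊆ S → ratio G X ≤ ratio G S → ∣ X ∣ <ℕ ∣ S ∣ → Nonempty X →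
      ConnectedRefinement S
    recurse X⊆S X≤S ∣X∣<∣S∣ neX =
      refinement-widen X⊆S X≤S (connected-refinement _ (smaller ∣X∣<∣S∣) neX)

    refine : Dec (Nonempty R) → ConnectedRefinement S
    refine (no noRest) = record
      { part = S ; part⊆ = λ x∈S → x∈S ; nonempty = u , u∈S
      ; connected = connected u∈S noRest ; ratio≤ = ≤-refl }
    refine (yes (r , r∈R)) with ratio-split separation (u , u∈T u∈S) (r , r∈R)
    ... | inj₁ T≤S = recurse T⊆A T≤S (∣T∣<∣A∣ r∈R) (u , u∈T u∈S)
    ... | inj₂ R≤S = recurse R⊆A R≤S (∣R∣<∣A∣ u∈S) (r , r∈R)

module _ {n : ℕ} (G : WGraph n) where

  subpartition? : ∀ k → Decidable (IsSubpartition G k)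
  subpartition? k A =
    all? (λ i → nonempty? (A i)) ×-dec
    all? (λ i → all? (λ j → ¬? (i ≟Fin j) →-dec all? (λ u → (u ∈? A i) →-dec ¬? (u ∈? A j))))

  subpartition-resp : ∀ {k} {A B : Fin k → Subset n} → (∀ i → A i ≡ B i) →
    IsSubpartition G k A → IsSubpartition G k B
  subpartition-resp A≡B (nonemptyA , disjointA) =
    (λ i → subst Nonempty (A≡B i) (nonemptyA i)) ,
    (λ i j i≢j u u∈Bi u∈Bj →
      disjointA i j i≢j u (subst (u ∈_) (sym (A≡B i)) u∈Bi) (subst (u ∈_) (sym (A≡B j)) u∈Bj))

  singletons : ∀ {k} → k ≤ℕ n → Fin k → Subset n
  singletons k≤n i = ⁅ inject≤ i k≤n ⁆

  singletons-subpartition : ∀ {k} (k≤n : k ≤ℕ n) → IsSubpartition G k (singletons k≤n)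
  singletons-subpartition k≤n =
    (λ i → inject≤ i k≤n , x∈⁅x⁆ _) ,
    (λ i j i≢j u u∈i u∈j →
      i≢j (inject≤-injective k≤n k≤n i j (trans (sym (x∈⁅y⁆⇒x≡y _ u∈i)) (x∈⁅y⁆⇒x≡y _ u∈j))))

  RatioMonotone : (k : ℕ) → ((Fin k → Subset n) → ℚ) → Set
  RatioMonotone k obj = ∀ A B → (∀ i → ratio G (A i) ≤ ratio G (B i)) → obj A ≤ obj B

  objm-monotone : ∀ k → RatioMonotone k (objm G k)
  objm-monotone zero    A B _   = ≤-refl
  objm-monotone (suc k) A B A≤B =
    /'-monoˡ-≤ (positive⁻¹ (normalize (suc k) 1) {{normalize-pos (suc k) 1}}) (sumFin-mono (suc k) A≤B)

  objM-monotone : ∀ k → RatioMonotone k (objM G k)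
  objM-monotone k A B = maxFin-mono k

  minimiser : ∀ {k} obj → RatioMonotone k obj → k ≤ℕ n → Σ (Fin k → Subset n) (Attains G k obj)
  minimiser {k} obj mono k≤n = best , valid , optimal
    where
    candidates : List (Fin k → Subset n)
    candidates = filter (subpartition? k) (families n k)

    best : Fin k → Subset n
    best = argmin obj (singletons k≤n) candidates

    valid : IsSubpartition G k best
    valid = argmin-all obj {P = IsSubpartition G k}
      (singletons-subpartition k≤n) (all-filter (subpartition? k) (families n k))

    optimal : ∀ B → IsSubpartition G k B → obj best ≤ obj B
    optimal B subB with families-complete B
    ... | F , F∈families , F≡B = ≤-trans
      (All.lookup (f[argmin]≤f[xs] (singletons k≤n) candidates)
        (∈-filter⁺ (subpartition? k) F∈families (subpartition-resp (sym ∘ F≡B) subB)))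
      (mono F B (λ i → ≤-reflexive (cong (ratio G) (F≡B i))))

  refine-parts : ∀ {k} {A : Fin k → Subset n} → IsSubpartition G k A →
    Σ (Fin k → Subset n) λ A' → IsSubpartition G k A' ×
      (∀ i → InducedConnected G (A' i)) × (∀ i → ratio G (A' i) ≤ ratio G (A i))
  refine-parts {A = A} (nonemptyA , disjointA) =
    part ∘ ref ,
    (nonempty ∘ ref , λ i j i≢j u u∈i u∈j → disjointA i j i≢j u (part⊆ (ref i) u∈i) (part⊆ (ref j) u∈j)) ,
    connected ∘ ref , ratio≤ ∘ ref
    where
    open ConnectedRefinement
    ref : ∀ i → ConnectedRefinement G (A i)
    ref i = connected-refinement G (A i) (<-wellFounded _) (nonemptyA i)

  connected-minimiser : ∀ {k} obj → RatioMonotone k obj → k ≤ℕ n →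
    Σ (Fin k → Subset n) λ A → Attains G k obj A × (∀ i → InducedConnected G (A i))
  connected-minimiser obj mono k≤n with minimiser obj mono k≤n
  ... | A , subA , optimalA with refine-parts subA
  ...   | A' , subA' , connectedA' , A'≤A =
          A' , (subA' , λ B subB → ≤-trans (mono A' A A'≤A) (optimalA B subB)) , connectedA'

-- Lemma 2: both ι^m_k and ι^M_k are attained by k-subpartitions whose
-- parts induce connected subgraphs.  (The argument only needs k ≤ n.)
lemma2 : (n : ℕ) (G : WGraph n) (k : ℕ) → 2 ≤ℕ k → k ≤ℕ n →
    (Σ (Fin k → Subset n) λ A → Attains G k (objm G k) A × (∀ i → InducedConnected G (A i)))
    × (Σ (Fin k → Subset n) λ A → Attains G k (objM G k) A × (∀ i → InducedConnected G (A i)))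
lemma2 n G k _ k≤n =
  connected-minimiser G (objm G k) (objm-monotone G k) k≤n ,
  connected-minimiser G (objM G k) (objM-monotone G k) k≤n
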